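{- Let $\mathbf{M}=(M;\leq,0,1)$ be a non-trivial complete lattice, let $S$ be a non-empty set and $R\subseteq S\times S$, and let $\mathbf{B}$ be a bounded subposet of $\mathbf{M}^{S}$ such that $\{0,1\}^{S}\subseteq B$. Let $P_R\colon B\to M^S$ and $T_R\colon B\to M^S$ be the lower and upper transition operators constructed by means of $(S,R)$. Then $R=R^{P_R}=R_{T_R}$.
   Context: Non-trivial means $0\neq 1$. $\mathbf{M}^S$ is ordered componentwise; a bounded subposet of $\mathbf{M}^S$ is a subset containing the constant tuples $0$ and $1$ with the inherited order; $\{0,1\}^S$ denotes the set of tuples all of whose components are the bottom $0$ or top $1$ of $M$. For $s\in S$ and $m\in M^S$, $s(m)$ denotes the $s$-th component of $m$; $sRt$ means $(s,t)\in R$. $T_R(b)(s)=\bigwedge_M\{t(b)\mid sRt\}$ and $P_R(a)(t)=\bigvee_M\{s(a)\mid sRt\}$ for $a,b\in B$, $s,t\in S$ (empty meet $=1$, empty join $=0$). For $T\colon B\to M^S$, $R_T=\{(s,t)\in S\times S\mid \forall b\in B:\ s(T(b))\leq t(b)\}$; for $P\colon B\to M^S$, $R^{P}=\{(s,t)\in S\times S\mid \forall a\in B:\ s(a)\leq t(P(a))\}$. -}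

module Defs where

open import Level using (Level; _⊔_) renaming (suc to lsuc)
open import Data.Product using (Σ; _,_; proj₁; proj₂)
open import Relation.Binary.Bundles using (Poset)

-- Bottom 0 and top 1 are included as fields (they are the join / meet of
-- the empty family).
record CompleteLattice (c ℓ₁ ℓ₂ ι : Level) : Set (lsuc (c ⊔ ℓ₁ ⊔ ℓ₂ ⊔ ι)) where
  field
    poset : Poset c ℓ₁ ℓ₂
  open Poset poset public
  field
    ⋀ : {I : Set ι} → (I → Carrier) → Carrier
    ⋀-lower : {I : Set ι} (f : I → Carrier) (i : I) → ⋀ f ≤ f i
    ⋀-greatest : {I : Set ι} (f : I → Carrier) (x : Carrier) →
                 (∀ i → x ≤ f i) → x ≤ ⋀ f
    ⋁ : {I : Set ι} → (I → Carrier) → Carrier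
    ⋁-upper : {I : Set ι} (f : I → Carrier) (i : I) → f i ≤ ⋁ f
    ⋁-least : {I : Set ι} (f : I → Carrier) (x : Carrier) →
              (∀ i → f i ≤ x) → ⋁ f ≤ x
    𝟘 : Carrier
    𝟘-least : ∀ x → 𝟘 ≤ x
    𝟙 : Carrier
    𝟙-greatest : ∀ x → x ≤ 𝟙

module _ {c ℓ₁ ℓ₂ ι β : Level} (L : CompleteLattice c ℓ₁ ℓ₂ ι)
         {S : Set ι} (B : (S → CompleteLattice.Carrier L) → Set β) where
  open CompleteLattice L

  El : Set (c ⊔ ι ⊔ β)
  El = Σ (S → Carrier) B

  T[_] : (S → S → Set ι) → El → S → Carrier
  T[ R ] b s = ⋀ {I = Σ S (R s)} (λ p → proj₁ b (proj₁ p))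

  P[_] : (S → S → Set ι) → El → S → Carrier
  P[ R ] a t = ⋁ {I = Σ S (λ s → R s t)} (λ p → proj₁ a (proj₁ p))

  R₍_₎ : (El → S → Carrier) → S → S → Set (c ⊔ ι ⊔ β ⊔ ℓ₂)
  R₍ T ₎ s t = (b : El) → T b s ≤ proj₁ b t

  R⁽_⁾ : (El → S → Carrier) → S → S → Set (c ⊔ ι ⊔ β ⊔ ℓ₂)
  R⁽ P ⁾ s t = (a : El) → proj₁ a s ≤ P a t

module Submission where

-- The inclusions
-- R ⊆ R^{P_R} and R ⊆ R_{T_R} hold for any B: a predecessor s of t
-- contributes a(s) to the join P_R(a)(t), and a successor t of s
-- contributes b(t) to the meet T_R(b)(s).
--
-- For the converse inclusions we test against {0,1}-valued elements of B.
-- If s is not a predecessor of t, the element a that is 1 exactly off the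
-- predecessors of t gives 1 ≤ a(s) ≤ P_R(a)(t) ≤ 0; dually, if t is not a
-- successor of s, the indicator b of the successors of s gives
-- 1 ≤ T_R(b)(s) ≤ b(t) ≤ 0.  Either way M would be trivial, so ¬¬ sRt,
-- and decidability of R (supplied by excluded middle) yields sRt.

open import Defs
open import Level using (Level; _⊔_)
open import Data.Product using (_×_; _,_; proj₁)
open import Data.Sum using (_⊎_; inj₁; inj₂)
open import Relation.Nullary using (¬_; Dec; yes; no; contradiction)
open import Relation.Nullary.Decidable using (¬?; decidable-stable)
open import Relation.Binary.Core using (_⇔_)
open import Axiom.ExcludedMiddle using (ExcludedMiddle)

module TransitionRelations
  {c ℓ₁ ℓ₂ ι β : Level} (L : CompleteLattice c ℓ₁ ℓ₂ ι)
  {S : Set ι} (B : (S → CompleteLattice.Carrier L) → Set β)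
  (R : S → S → Set ι) where

  open CompleteLattice L

  IsBoolean : (S → Carrier) → Set (ℓ₁ ⊔ ι)
  IsBoolean m = ∀ s → m s ≈ 𝟘 ⊎ m s ≈ 𝟙

  BooleansIn : Set (c ⊔ ℓ₁ ⊔ ι ⊔ β)
  BooleansIn = (m : S → Carrier) → IsBoolean m → B m

  χ : {A : Set ι} → Dec A → Carrier
  χ (yes _) = 𝟙
  χ (no _)  = 𝟘

  χ-boolean : {A : Set ι} (d : Dec A) → χ d ≈ 𝟘 ⊎ χ d ≈ 𝟙
  χ-boolean (yes _) = inj₂ Eq.refl
  χ-boolean (no _)  = inj₁ Eq.refl

  χ-true : {A : Set ι} (d : Dec A) → A → 𝟙 ≤ χ d
  χ-true (yes _) _  = refl
  χ-true (no ¬a) a  = contradiction a ¬a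

  χ-false : {A : Set ι} (d : Dec A) → ¬ A → χ d ≤ 𝟘
  χ-false (yes a) ¬a = contradiction a ¬a
  χ-false (no _)  _  = refl

  top≰bottom : ¬ (𝟘 ≈ 𝟙) → ¬ (𝟙 ≤ 𝟘)
  top≰bottom nontrivial 𝟙≤𝟘 = nontrivial (antisym (𝟘-least 𝟙) 𝟙≤𝟘)

  R⊆R^P : ∀ {s t} → R s t → R⁽ L ⁾ B (P[_] L B R) s t
  R⊆R^P {s} r a = ⋁-upper (λ p → proj₁ a (proj₁ p)) (s , r)

  R⊆R_T : ∀ {s t} → R s t → R₍_₎ L B (T[_] L B R) s t
  R⊆R_T {t = t} r b = ⋀-lower (λ p → proj₁ b (proj₁ p)) (t , r)

  module _ (R? : ∀ s t → Dec (R s t)) (booleans : BooleansIn)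
           (nontrivial : ¬ (𝟘 ≈ 𝟙)) where

    nonPredecessors : S → El L B
    nonPredecessors t = m , booleans m (λ x → χ-boolean (¬? (R? x t)))
      where m = λ x → χ (¬? (R? x t))

    successors : S → El L B
    successors s = m , booleans m (λ x → χ-boolean (R? s x))
      where m = λ x → χ (R? s x)

    P-nonPredecessors≤𝟘 : ∀ t → P[_] L B R (nonPredecessors t) t ≤ 𝟘
    P-nonPredecessors≤𝟘 t =
      ⋁-least _ 𝟘 (λ (x , r) → χ-false (¬? (R? x t)) (λ ¬r → contradiction r ¬r))

    𝟙≤T-successors : ∀ s → 𝟙 ≤ T[_] L B R (successors s) s
    𝟙≤T-successors s = ⋀-greatest _ 𝟙 (λ (x , r) → χ-true (R? s x) r)

    R^P⊆R : ∀ {s t} → R⁽ L ⁾ B (P[_] L B R) s t → R s t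
    R^P⊆R {s} {t} below = decidable-stable (R? s t) λ ¬r →
      top≰bottom nontrivial
        (trans (χ-true (¬? (R? s t)) ¬r)
        (trans (below (nonPredecessors t)) (P-nonPredecessors≤𝟘 t)))

    R_T⊆R : ∀ {s t} → R₍_₎ L B (T[_] L B R) s t → R s t
    R_T⊆R {s} {t} above = decidable-stable (R? s t) λ ¬r →
      top≰bottom nontrivial
        (trans (𝟙≤T-successors s)
        (trans (above (successors s)) (χ-false (R? s t) ¬r)))

corollary2p7 : {c ℓ₁ ℓ₂ ι β : Level} → ExcludedMiddle ι →
    (L : CompleteLattice c ℓ₁ ℓ₂ ι) →
    ¬ (CompleteLattice._≈_ L (CompleteLattice.𝟘 L) (CompleteLattice.𝟙 L)) →
    (S : Set ι) → S → (R : S → S → Set ι) →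
    (B : (S → CompleteLattice.Carrier L) → Set β) →
    B (λ _ → CompleteLattice.𝟘 L) → B (λ _ → CompleteLattice.𝟙 L) →
    ((m : S → CompleteLattice.Carrier L) →
    ((s : S) → CompleteLattice._≈_ L (m s) (CompleteLattice.𝟘 L) ⊎ CompleteLattice._≈_ L (m s) (CompleteLattice.𝟙 L)) →
    B m) →
    (R ⇔ R⁽ L ⁾ B (P[_] L B R)) × (R ⇔ R₍_₎ L B (T[_] L B R))
corollary2p7 em L nontrivial S _ R B _ _ booleans =
  (R⊆R^P , R^P⊆R R? booleans nontrivial) ,
  (R⊆R_T , R_T⊆R R? booleans nontrivial)
  where
  open TransitionRelations L B R
  R? : ∀ s t → Dec (R s t)
  R? s t = em
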